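{- For every integer $t\geq 0$, $\mathit{fw}(abc(acb)^{t})=2t+1$, where $a,b,c$ are distinct letters.
   Context: A sequence $s$ contains a sequence $u$ if some subsequence of $s$ can be changed into $u$ by a one-to-one renaming of its letters. An $(r,s)$-formation is a concatenation of $s$ permutations of the same set of $r$ distinct letters. The formation width $\mathit{fw}(u)$ is the minimum $s$ such that there exists $r$ for which every $(r,s)$-formation contains $u$. $(acb)^t$ denotes $acb$ repeated $t$ times. -}

module Defs where

open import Data.Nat using (ℕ; _<_; suc)
open import Data.List using (List; []; _∷_; _++_; map; length; concat; replicate)
open import Data.List.Membership.Propositional using (_∈_)
open import Data.List.Relation.Unary.All using (All)
open import Data.List.Relation.Unary.Unique.Propositional using (Unique)
open import Data.List.Relation.Binary.Sublist.Propositional using (_⊆_)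
open import Data.List.Relation.Binary.Permutation.Propositional using (_↭_)
open import Data.Product using (Σ; ∃; _×_)
open import Relation.Binary.PropositionalEquality using (_≡_)
open import Relation.Nullary using (¬_)

Seq : Set
Seq = List ℕ

Contains : Seq → Seq → Set
Contains s u =
  Σ Seq λ v → (v ⊆ s) ×
    Σ (ℕ → ℕ) λ f →
      (∀ {x y} → x ∈ v → y ∈ v → f x ≡ f y → x ≡ y) × (map f v ≡ u)

IsFormation : ℕ → ℕ → Seq → Set
IsFormation r s w =
  Σ Seq λ L → Unique L × (length L ≡ r) ×
    Σ (List Seq) λ ps → (length ps ≡ s) × All (_↭ L) ps × (w ≡ concat ps)

AllFormationsContain : ℕ → ℕ → Seq → Set
AllFormationsContain r s u = ∀ w → IsFormation r s w → Contains w u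

FwProp : Seq → ℕ → Set
FwProp u s = ∃ λ r → AllFormationsContain r s u

FwIs : Seq → ℕ → Set
FwIs u n = FwProp u n × (∀ s → s < n → ¬ FwProp u s)

a b c : ℕ
a = 0
b = 1
c = 2

abcACBt : ℕ → Seq
abcACBt t = a ∷ b ∷ c ∷ concat (replicate t (a ∷ c ∷ b ∷ []))

-- Take r = esTower (2t) and a formation B₀ B₁ … B₂ₜ. Applying Erdős–Szekeres inside B₀
-- once for each later block leaves three letters x y z, in this order in B₀, that every later block
-- lists as xyz or as zyx. Renamed to a b c, the formation thus contains abc followed by 2t blocks abc or
-- cba, and such a word contains abc(acb)^t or its renaming acb(abc)^t: embedding both periodic words
-- greedily at once, every block advances the two embeddings by 3 letters in total (up to a bounded
-- potential), so after 2t blocks one of them has embedded 3t letters.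
--
-- For s ≤ 2t the formation 0…r−1, r−1…0, 0…r−1, … with s blocks avoids abc(acb)^t. An
-- occurrence involves only three letters; restricted to them the formation alternates an arrangement π
-- of a b c with its reverse, and in each of the six cases greedy embedding leaves a nonempty residue
-- that each further pair of blocks merely moves along the word by one acb.

module Submission where

open import Defs
open import Data.Nat using (ℕ; zero; suc; _+_; _*_; _≤_; _<_; z≤n; s≤s; _≟_; _≤?_)
open import Data.Bool using (Bool; true; false)
open import Data.Empty using (⊥-elim)
open import Data.List using (List; []; _∷_; [_]; _++_; map; length; concat; replicate; reverse; filter; upTo)
open import Data.List.Properties
  using (++-assoc; ++-identityʳ; map-∘; map-id-local; map-cong; map-++; filter-++; filter-all;
         unfold-reverse; reverse-map; ∷-injectiveˡ; ∷-injectiveʳ; length-upTo)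
open import Data.List.Membership.Propositional using (_∈_)
open import Data.List.Membership.Propositional.Properties using (∈-∃++; ∈-map⁺; ∈-map⁻; ∈-filter⁺; ∈-++⁻)
open import Data.List.Membership.DecPropositional _≟_ using (_∈?_)
open import Data.List.Relation.Binary.Sublist.DecPropositional _≟_ using (_⊆?_)
open import Data.List.Relation.Unary.Any using (here; there)
open import Data.List.Relation.Unary.All as All using (All; []; _∷_)
open import Data.List.Relation.Unary.All.Properties using (all-filter)
open import Data.List.Relation.Unary.AllPairs using (AllPairs; []; _∷_)
open import Data.List.Relation.Unary.Unique.Propositional using (Unique)
import Data.List.Relation.Unary.Unique.Propositional.Properties as Unique
open import Data.List.Relation.Binary.Sublist.Propositional
  using (_⊆_; []; _∷_; _∷ʳ_; ⊆-refl; ⊆-trans; minimum; from∈; to∈; lookup)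
open import Data.List.Relation.Binary.Sublist.Propositional.Properties
  using (All-resp-⊆; ∷ˡ⁻; ++⁺; map⁺; filter⁺)
open import Data.List.Relation.Binary.Permutation.Propositional using (_↭_; ↭-refl; ↭-sym; ↭-trans; ↭⇒↭ₛ)
open import Data.List.Relation.Binary.Permutation.Propositional.Properties
  using (∈-resp-↭; ↭-length; ↭-reverse; shift)
open import Data.Nat.GeneralisedArithmetic using (iterate)
open import Data.Nat.Properties
open import Data.Product using (∃; _×_; _,_)
open import Data.Sum as Sum using (_⊎_; inj₁; inj₂)
open import Function using (flip; _∘_)
open import Relation.Binary.PropositionalEquality
  using (_≡_; _≢_; refl; sym; trans; cong; subst; subst₂; setoid; module ≡-Reasoning)
open import Data.List.Relation.Binary.Permutation.Setoid.Properties (setoid ℕ) using (Unique-resp-↭)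
open import Relation.Nullary using (¬_; yes; no; does)
open import Relation.Unary using (Pred; Decidable)
open import Level using (0ℓ)
open import Relation.Nullary.Decidable using (True; toWitness)

private
  variable
    A : Set

m+n≤o+p∧o<m⇒n<p : ∀ {m n o p} → m + n ≤ o + p → o < m → n < p
m+n≤o+p∧o<m⇒n<p {m} {n} {o} {p} le o<m = +-cancelˡ-≤ o (suc n) p (begin
  o + suc n ≡⟨ +-suc o n ⟩
  suc o + n ≤⟨ +-monoˡ-≤ n o<m ⟩
  m + n     ≤⟨ le ⟩
  o + p     ∎)
  where open ≤-Reasoning

AllPairs-resp-⊆ : ∀ {R : A → A → Set} {xs ys} → xs ⊆ ys → AllPairs R ys → AllPairs R xs
AllPairs-resp-⊆ []         []         = []
AllPairs-resp-⊆ (y ∷ʳ xs⊆) (_ ∷ rys)  = AllPairs-resp-⊆ xs⊆ rys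
AllPairs-resp-⊆ (refl ∷ xs⊆) (ry ∷ rys) = All-resp-⊆ xs⊆ ry ∷ AllPairs-resp-⊆ xs⊆ rys

Unique-resp-↭ˡ : ∀ {xs ys : Seq} → xs ↭ ys → Unique ys → Unique xs
Unique-resp-↭ˡ xs↭ys = Unique-resp-↭ (↭⇒↭ₛ (↭-sym xs↭ys))

Unique⇒length≤ : ∀ {xs ys : List A} → Unique xs → All (_∈ ys) xs → length xs ≤ length ys
Unique⇒length≤ [] [] = z≤n
Unique⇒length≤ {xs = x ∷ xs} (x∉xs ∷ uxs) (x∈ys ∷ xs⊆ys) with ∈-∃++ x∈ys
... | as , bs , refl = subst (suc (length xs) ≤_) (sym (↭-length (shift x as bs)))
        (s≤s (Unique⇒length≤ uxs (All.zipWith outside-x (x∉xs , xs⊆ys))))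
  where
  outside-x : ∀ {y} → x ≢ y × y ∈ as ++ [ x ] ++ bs → y ∈ as ++ bs
  outside-x (x≢y , y∈ys) with ∈-resp-↭ (shift x as bs) y∈ys
  ... | here y≡x   = ⊥-elim (x≢y (sym y≡x))
  ... | there y∈zs = y∈zs

InjectiveOn : (ℕ → ℕ) → Seq → Set
InjectiveOn σ u = ∀ {i j} → i ∈ u → j ∈ u → σ i ≡ σ j → i ≡ j

-- 0 is a junk value: preimage σ u is only ever applied to σ-images of letters of u.
preimage : (ℕ → ℕ) → Seq → ℕ → ℕ
preimage σ []      n = 0
preimage σ (i ∷ u) n with σ i ≟ n
... | yes _ = i
... | no  _ = preimage σ u n

preimage-σ : ∀ σ u {i} → InjectiveOn σ u → i ∈ u → preimage σ u (σ i) ≡ i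
preimage-σ σ (j ∷ u) {i} inj i∈u with σ j ≟ σ i | i∈u
... | yes σj≡σi | _          = inj (here refl) i∈u σj≡σi
... | no σj≢σi  | here refl  = ⊥-elim (σj≢σi refl)
... | no _      | there i∈u′ = preimage-σ σ u (λ p q → inj (there p) (there q)) i∈u′

map⁺⇒Contains : ∀ σ {u w} → InjectiveOn σ u → map σ u ⊆ w → Contains w u
map⁺⇒Contains σ {u} inj σu⊆w = map σ u , σu⊆w , preimage σ u , injective , inverse
  where
  left-inverse : ∀ {i} → i ∈ u → preimage σ u (σ i) ≡ i
  left-inverse = preimage-σ σ u inj

  injective : ∀ {x y} → x ∈ map σ u → y ∈ map σ u → preimage σ u x ≡ preimage σ u y → x ≡ y
  injective x∈ y∈ eq with ∈-map⁻ σ x∈ | ∈-map⁻ σ y∈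
  ... | i , i∈u , refl | j , j∈u , refl =
    cong σ (trans (sym (left-inverse i∈u)) (trans eq (left-inverse j∈u)))

  inverse : map (preimage σ u) (map σ u) ≡ u
  inverse = trans (sym (map-∘ u)) (map-id-local (All.tabulate left-inverse))

rename3 : ℕ → ℕ → ℕ → ℕ → ℕ
rename3 x y z 0 = x
rename3 x y z 1 = y
rename3 x y z _ = z

rename3-injective : ∀ {x y z} → x ≢ y → x ≢ z → y ≢ z →
                    ∀ {i j} → i < 3 → j < 3 → rename3 x y z i ≡ rename3 x y z j → i ≡ j
rename3-injective x≢y x≢z y≢z {0} {0} _ _ _ = refl
rename3-injective x≢y x≢z y≢z {0} {1} _ _ e = ⊥-elim (x≢y e)
rename3-injective x≢y x≢z y≢z {0} {2} _ _ e = ⊥-elim (x≢z e)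
rename3-injective x≢y x≢z y≢z {1} {0} _ _ e = ⊥-elim (x≢y (sym e))
rename3-injective x≢y x≢z y≢z {1} {1} _ _ _ = refl
rename3-injective x≢y x≢z y≢z {1} {2} _ _ e = ⊥-elim (y≢z e)
rename3-injective x≢y x≢z y≢z {2} {0} _ _ e = ⊥-elim (x≢z (sym e))
rename3-injective x≢y x≢z y≢z {2} {1} _ _ e = ⊥-elim (y≢z (sym e))
rename3-injective x≢y x≢z y≢z {2} {2} _ _ _ = refl
rename3-injective _ _ _ {suc (suc (suc _))} (s≤s (s≤s (s≤s ()))) _ _
rename3-injective _ _ _ {j = suc (suc (suc _))} _ (s≤s (s≤s (s≤s ()))) _

acb^ : ℕ → Seq
acb^ t = concat (replicate t (a ∷ c ∷ b ∷ []))

abcACBt-letters : ∀ t → All (_< 3) (abcACBt t)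
abcACBt-letters t = s≤s z≤n ∷ s≤s (s≤s z≤n) ∷ s≤s (s≤s (s≤s z≤n)) ∷ acb^-letters t
  where
  acb^-letters : ∀ t → All (_< 3) (acb^ t)
  acb^-letters zero    = []
  acb^-letters (suc t) = s≤s z≤n ∷ s≤s (s≤s (s≤s z≤n)) ∷ s≤s (s≤s z≤n) ∷ acb^-letters t

Contains-rename3 : ∀ {x y z w} t → x ≢ y → x ≢ z → y ≢ z →
                   map (rename3 x y z) (abcACBt t) ⊆ w → Contains w (abcACBt t)
Contains-rename3 t x≢y x≢z y≢z =
  map⁺⇒Contains _ λ i∈ j∈ → rename3-injective x≢y x≢z y≢z (All.lookup letters i∈) (All.lookup letters j∈)
  where letters = abcACBt-letters t

-- The Erdős–Szekeres theorem

HasChain : (A → A → Set) → ℕ → List A → Set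
HasChain R n xs = ∃ λ ys → ys ⊆ xs × length ys ≡ n × AllPairs R ys

HasChain-⊆ : ∀ {R : A → A → Set} {n xs ys} → xs ⊆ ys → HasChain R n xs → HasChain R n ys
HasChain-⊆ xs⊆ys (zs , zs⊆xs , len , chain) = zs , ⊆-trans zs⊆xs xs⊆ys , len , chain

HasChain-∷ : ∀ {R : A → A → Set} {n x xs} → All (R x) xs → HasChain R n xs → HasChain R (suc n) (x ∷ xs)
HasChain-∷ Rx (zs , zs⊆xs , len , chain) =
  _ ∷ zs , refl ∷ zs⊆xs , cong suc len , All-resp-⊆ zs⊆xs Rx ∷ chain

esBound : ℕ → ℕ → ℕ
esBound zero    q       = 0
esBound (suc p) zero    = 0
esBound (suc p) (suc q) = suc (esBound p (suc q) + esBound (suc p) q)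

module ErdősSzekeres {M : A → Set} (R : A → A → Set)
                     (R-total : ∀ {x y} → M x → M y → x ≢ y → R x y ⊎ R y x) where

  record Split (x : A) (xs : List A) : Set where
    constructor split
    field
      above below  : List A
      above⊆       : above ⊆ xs
      below⊆       : below ⊆ xs
      length-split : length above + length below ≡ length xs
      R-above      : All (R x) above
      R-below      : All (flip R x) below

  partition : ∀ {x} xs → M x → All M xs → All (x ≢_) xs → Split x xs
  partition [] _ [] [] = split [] [] [] [] refl [] []
  partition (y ∷ xs) mx (my ∷ mxs) (x≢y ∷ x≢xs) with partition xs mx mxs x≢xs | R-total mx my x≢y
  ... | split U D U⊆ D⊆ len RU RD | inj₁ Rxy =
    split (y ∷ U) D (refl ∷ U⊆) (y ∷ʳ D⊆) (cong suc len) (Rxy ∷ RU) RD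
  ... | split U D U⊆ D⊆ len RU RD | inj₂ Ryx =
    split U (y ∷ D) (y ∷ʳ U⊆) (refl ∷ D⊆) (trans (+-suc _ _) (cong suc len)) RU (Ryx ∷ RD)

  erdős-szekeres : ∀ p q xs → Unique xs → All M xs → esBound p q ≤ length xs →
                   HasChain R p xs ⊎ HasChain (flip R) q xs
  erdős-szekeres zero    q       xs _ _ _ = inj₁ ([] , minimum xs , refl , [])
  erdős-szekeres (suc p) zero    xs _ _ _ = inj₂ ([] , minimum xs , refl , [])
  erdős-szekeres (suc p) (suc q) (x ∷ xs) (x∉xs ∷ uxs) (mx ∷ mxs) (s≤s bound)
    with partition xs mx mxs x∉xs
  ... | split U D U⊆ D⊆ len RU RD with esBound p (suc q) ≤? length U
  ...   | yes bound-U =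
    Sum.map (HasChain-⊆ (refl ∷ U⊆) ∘ HasChain-∷ RU) (HasChain-⊆ (x ∷ʳ U⊆))
            (erdős-szekeres p (suc q) U (AllPairs-resp-⊆ U⊆ uxs) (All-resp-⊆ U⊆ mxs) bound-U)
  ...   | no ¬bound-U =
    Sum.map (HasChain-⊆ (x ∷ʳ D⊆)) (HasChain-⊆ (refl ∷ D⊆) ∘ HasChain-∷ RD)
            (erdős-szekeres (suc p) q D (AllPairs-resp-⊆ D⊆ uxs) (All-resp-⊆ D⊆ mxs) bound-D)
    where
    bound-D : esBound (suc p) q ≤ length D
    bound-D = <⇒≤ (m+n≤o+p∧o<m⇒n<p (subst (_ ≤_) (sym len) bound) (≰⇒> ¬bound-U))

-- Upper bound

module Orbit {P : Set} (letter : P → ℕ) (next : P → P) where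

  word : P → ℕ → Seq
  word p zero    = []
  word p (suc n) = letter p ∷ word (next p) n

  advance : P → ℕ → P
  advance = iterate next

  advance-+ : ∀ p m n → advance p (m + n) ≡ advance (advance p m) n
  advance-+ p zero    n = refl
  advance-+ p (suc m) n = advance-+ (next p) m n

  word-+ : ∀ p m n → word p (m + n) ≡ word p m ++ word (advance p m) n
  word-+ p zero    n = refl
  word-+ p (suc m) n = cong (letter p ∷_) (word-+ (next p) m n)

  word-mono : ∀ p {m n} → m ≤ n → word p m ⊆ word p n
  word-mono p z≤n       = minimum _
  word-mono p (s≤s m≤n) = refl ∷ word-mono (next p) m≤n

  word-extend : ∀ pre p m d {W B} → pre ++ word p m ⊆ W → word (advance p m) d ⊆ B →
                pre ++ word p (m + d) ⊆ W ++ B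
  word-extend pre p m d pw⊆W w⊆B
    rewrite word-+ p m d | sym (++-assoc pre (word p m) (word (advance p m) d)) = ++⁺ pw⊆W w⊆B

block : Bool → Seq
block true  = a ∷ b ∷ c ∷ []
block false = c ∷ b ∷ a ∷ []

data Phase₁ : Set where
  a₁ c₁ b₁ : Phase₁

letter₁ : Phase₁ → ℕ
letter₁ a₁ = a
letter₁ c₁ = c
letter₁ b₁ = b

next₁ : Phase₁ → Phase₁
next₁ a₁ = c₁
next₁ c₁ = b₁
next₁ b₁ = a₁

data Phase₂ : Set where
  b₀ a₂ b₂ c₂ : Phase₂

letter₂ : Phase₂ → ℕ
letter₂ b₀ = b
letter₂ a₂ = a
letter₂ b₂ = b
letter₂ c₂ = c

next₂ : Phase₂ → Phase₂
next₂ b₀ = a₂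
next₂ a₂ = b₂
next₂ b₂ = c₂
next₂ c₂ = a₂

module O₁ = Orbit letter₁ next₁
module O₂ = Orbit letter₂ next₂

acb^≡word₁ : ∀ t → acb^ t ≡ O₁.word a₁ (3 * t)
acb^≡word₁ zero = refl
acb^≡word₁ (suc t) =
  trans (cong (λ w → a ∷ c ∷ b ∷ w) (acb^≡word₁ t)) (cong (O₁.word a₁) (sym (*-suc 3 t)))

acb^-renamed≡word₂ : ∀ t → map (rename3 a c b) (acb^ t) ≡ O₂.word a₂ (3 * t)
acb^-renamed≡word₂ zero = refl
acb^-renamed≡word₂ (suc t) =
  trans (cong (λ w → a ∷ b ∷ c ∷ w) (acb^-renamed≡word₂ t)) (cong (O₂.word a₂) (sym (*-suc 3 t)))

-- Reachable pairs of phases of the greedy embeddings of  abc(acb)^∞  and  acb(abc)^∞,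
-- with a potential that makes every block advance the two embeddings by 3 in total.
data Joint : Phase₁ → Phase₂ → Set where
  a₁b₀ : Joint a₁ b₀
  a₁a₂ : Joint a₁ a₂
  c₁b₂ : Joint c₁ b₂
  c₁c₂ : Joint c₁ c₂
  b₁a₂ : Joint b₁ a₂

potential : ∀ {P₁ P₂} → Joint P₁ P₂ → ℕ
potential a₁b₀ = 0
potential a₁a₂ = 1
potential c₁b₂ = 0
potential c₁c₂ = 1
potential b₁a₂ = 0

data Progress (W : Seq) (k : ℕ) : Set where
  progress : ∀ m₁ m₂ {P₁ P₂} → O₁.advance a₁ m₁ ≡ P₁ → O₂.advance b₀ m₂ ≡ P₂ →
             a ∷ b ∷ c ∷ O₁.word a₁ m₁ ⊆ W → a ∷ c ∷ O₂.word b₀ m₂ ⊆ W →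
             (j : Joint P₁ P₂) → 3 * k + potential j ≤ m₁ + m₂ → Progress W k

potential-step : ∀ k φ φ′ m₁ m₂ d₁ d₂ → 3 * k + φ ≤ m₁ + m₂ → 3 + φ′ ≤ φ + (d₁ + d₂) →
                 3 * suc k + φ′ ≤ (m₁ + d₁) + (m₂ + d₂)
potential-step k φ φ′ m₁ m₂ d₁ d₂ before gain = begin
  3 * suc k + φ′            ≡⟨ cong (_+ φ′) (trans (*-suc 3 k) (+-comm 3 (3 * k))) ⟩
  (3 * k + 3) + φ′          ≡⟨ +-assoc (3 * k) 3 φ′ ⟩
  3 * k + (3 + φ′)          ≤⟨ +-monoʳ-≤ (3 * k) gain ⟩
  3 * k + (φ + (d₁ + d₂))   ≡⟨ +-assoc (3 * k) φ (d₁ + d₂) ⟨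
  (3 * k + φ) + (d₁ + d₂)   ≤⟨ +-monoˡ-≤ (d₁ + d₂) before ⟩
  (m₁ + m₂) + (d₁ + d₂)     ≡⟨ +-interchange m₁ m₂ d₁ d₂ ⟩
  (m₁ + d₁) + (m₂ + d₂)     ∎
  where
  open ≤-Reasoning
  open import Algebra.Properties.CommutativeSemigroup +-commutativeSemigroup
    using () renaming (interchange to +-interchange)

progress-extend : ∀ {W B k m₁ m₂ P₁ P₂} d₁ d₂ → O₁.advance a₁ m₁ ≡ P₁ → O₂.advance b₀ m₂ ≡ P₂ →
                  a ∷ b ∷ c ∷ O₁.word a₁ m₁ ⊆ W → a ∷ c ∷ O₂.word b₀ m₂ ⊆ W →
                  (j : Joint P₁ P₂) → 3 * k + potential j ≤ m₁ + m₂ →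
                  (j′ : Joint (O₁.advance P₁ d₁) (O₂.advance P₂ d₂)) →
                  O₁.word P₁ d₁ ⊆ B → O₂.word P₂ d₂ ⊆ B → 3 + potential j′ ≤ potential j + (d₁ + d₂) →
                  Progress (W ++ B) (suc k)
progress-extend {k = k} {m₁} {m₂} d₁ d₂ refl refl w₁⊆W w₂⊆W j before j′ w₁⊆B w₂⊆B gain =
  progress (m₁ + d₁) (m₂ + d₂) (O₁.advance-+ a₁ m₁ d₁) (O₂.advance-+ b₀ m₂ d₂)
           (O₁.word-extend (a ∷ b ∷ c ∷ []) a₁ m₁ d₁ w₁⊆W w₁⊆B)
           (O₂.word-extend (a ∷ c ∷ []) b₀ m₂ d₂ w₂⊆W w₂⊆B)
           j′ (potential-step k _ _ m₁ m₂ d₁ d₂ before gain)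

compute-⊆ : {xs ys : Seq} → True (xs ⊆? ys) → xs ⊆ ys
compute-⊆ = toWitness

compute-≤ : {m n : ℕ} → True (m ≤? n) → m ≤ n
compute-≤ = toWitness

-- dᵢ is how far the i-th greedy embedding gets inside the block; the side conditions hold by evaluation.
progress-block : ∀ {W k} → Progress W k → (o : Bool) → Progress (W ++ block o) (suc k)
progress-block (progress _ _ e₁ e₂ s₁ s₂ a₁b₀ bd) true  =
  progress-extend 2 1 e₁ e₂ s₁ s₂ a₁b₀ bd b₁a₂ (compute-⊆ _) (compute-⊆ _) (compute-≤ _)
progress-block (progress _ _ e₁ e₂ s₁ s₂ a₁b₀ bd) false =
  progress-extend 1 2 e₁ e₂ s₁ s₂ a₁b₀ bd c₁b₂ (compute-⊆ _) (compute-⊆ _) (compute-≤ _)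
progress-block (progress _ _ e₁ e₂ s₁ s₂ a₁a₂ bd) true  =
  progress-extend 2 3 e₁ e₂ s₁ s₂ a₁a₂ bd b₁a₂ (compute-⊆ _) (compute-⊆ _) (compute-≤ _)
progress-block (progress _ _ e₁ e₂ s₁ s₂ a₁a₂ bd) false =
  progress-extend 1 1 e₁ e₂ s₁ s₂ a₁a₂ bd c₁b₂ (compute-⊆ _) (compute-⊆ _) (compute-≤ _)
progress-block (progress _ _ e₁ e₂ s₁ s₂ c₁b₂ bd) true  =
  progress-extend 1 2 e₁ e₂ s₁ s₂ c₁b₂ bd b₁a₂ (compute-⊆ _) (compute-⊆ _) (compute-≤ _)
progress-block (progress _ _ e₁ e₂ s₁ s₂ c₁b₂ bd) false =
  progress-extend 3 1 e₁ e₂ s₁ s₂ c₁b₂ bd c₁c₂ (compute-⊆ _) (compute-⊆ _) (compute-≤ _)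
progress-block (progress _ _ e₁ e₂ s₁ s₂ c₁c₂ bd) true  =
  progress-extend 1 1 e₁ e₂ s₁ s₂ c₁c₂ bd b₁a₂ (compute-⊆ _) (compute-⊆ _) (compute-≤ _)
progress-block (progress _ _ e₁ e₂ s₁ s₂ c₁c₂ bd) false =
  progress-extend 3 2 e₁ e₂ s₁ s₂ c₁c₂ bd c₁b₂ (compute-⊆ _) (compute-⊆ _) (compute-≤ _)
progress-block (progress _ _ e₁ e₂ s₁ s₂ b₁a₂ bd) true  =
  progress-extend 1 3 e₁ e₂ s₁ s₂ b₁a₂ bd a₁a₂ (compute-⊆ _) (compute-⊆ _) (compute-≤ _)
progress-block (progress _ _ e₁ e₂ s₁ s₂ b₁a₂ bd) false =
  progress-extend 2 1 e₁ e₂ s₁ s₂ b₁a₂ bd c₁b₂ (compute-⊆ _) (compute-⊆ _) (compute-≤ _)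

progress-blocks : ∀ os {W k} → Progress W k → Progress (W ++ concat (map block os)) (k + length os)
progress-blocks [] {W} {k} p = subst₂ Progress (sym (++-identityʳ W)) (sym (+-identityʳ k)) p
progress-blocks (o ∷ os) {W} {k} p =
  subst₂ Progress (++-assoc W (block o) (concat (map block os))) (sym (+-suc k (length os)))
         (progress-blocks os (progress-block p o))

initial-progress : Progress (a ∷ b ∷ c ∷ []) 0
initial-progress = progress 0 0 refl refl (compute-⊆ _) (compute-⊆ _) a₁b₀ z≤n

orientations-contain : ∀ t os → length os ≡ 2 * t →
                       let W = a ∷ b ∷ c ∷ concat (map block os) in
                       abcACBt t ⊆ W ⊎ map (rename3 a c b) (abcACBt t) ⊆ W
orientations-contain t os len
  with progress-blocks os initial-progress
... | progress m₁ m₂ _ _ w₁⊆W w₂⊆W j bd with 3 * t ≤? m₁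
...   | yes 3t≤m₁ = inj₁ (⊆-trans (refl ∷ refl ∷ refl ∷ acb^⊆word₁) w₁⊆W)
  where
  acb^⊆word₁ : acb^ t ⊆ O₁.word a₁ m₁
  acb^⊆word₁ = subst (_⊆ O₁.word a₁ m₁) (sym (acb^≡word₁ t)) (O₁.word-mono a₁ 3t≤m₁)
...   | no  3t≰m₁ = inj₂ (⊆-trans (refl ∷ refl ∷ bacb^⊆word₂) w₂⊆W)
  where
  6t≤m₁+m₂ : 3 * t + 3 * t ≤ m₁ + m₂
  6t≤m₁+m₂ = subst (_≤ m₁ + m₂)
                   (trans (cong (3 *_) (trans len (cong (t +_) (+-identityʳ t)))) (*-distribˡ-+ 3 t t))
                   (≤-trans (m≤m+n _ (potential j)) bd)
  bacb^⊆word₂ : b ∷ map (rename3 a c b) (acb^ t) ⊆ O₂.word b₀ m₂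
  bacb^⊆word₂ = subst (λ w → b ∷ w ⊆ O₂.word b₀ m₂) (sym (acb^-renamed≡word₂ t))
                      (O₂.word-mono b₀ (m+n≤o+p∧o<m⇒n<p 6t≤m₁+m₂ (≰⇒> 3t≰m₁)))

Precedes : Seq → ℕ → ℕ → Set
Precedes B x y = x ∷ y ∷ [] ⊆ B

Precedes-total : ∀ {B x y} → x ∈ B → y ∈ B → x ≢ y → Precedes B x y ⊎ Precedes B y x
Precedes-total (here refl) (here refl)  x≢y = ⊥-elim (x≢y refl)
Precedes-total (here refl) (there y∈B)  _   = inj₁ (refl ∷ from∈ y∈B)
Precedes-total (there x∈B) (here refl)  _   = inj₂ (refl ∷ from∈ x∈B)
Precedes-total {b ∷ B} (there x∈B) (there y∈B) x≢y =
  Sum.map (b ∷ʳ_) (b ∷ʳ_) (Precedes-total x∈B y∈B x≢y)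

Precedes-chain : ∀ {B x y z} → Unique B → Precedes B x y → Precedes B y z → x ∷ y ∷ z ∷ [] ⊆ B
Precedes-chain (_ ∷ uB)    (b ∷ʳ xy)   (.b ∷ʳ yz) = b ∷ʳ Precedes-chain uB xy yz
Precedes-chain (b∉B ∷ _)   (b ∷ʳ xy)   (refl ∷ _) = ⊥-elim (All.lookup b∉B (to∈ (∷ˡ⁻ xy)) refl)
Precedes-chain (_ ∷ _)     (refl ∷ _)  (b ∷ʳ yz)  = refl ∷ yz
Precedes-chain (b∉B ∷ _)   (refl ∷ xy) (refl ∷ _) = ⊥-elim (All.lookup b∉B (to∈ xy) refl)

Monotone : Seq → Seq → Set
Monotone B S = AllPairs (Precedes B) S ⊎ AllPairs (flip (Precedes B)) S

Monotone-⊆ : ∀ {B S S′} → S′ ⊆ S → Monotone B S → Monotone B S′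
Monotone-⊆ S′⊆S = Sum.map (AllPairs-resp-⊆ S′⊆S) (AllPairs-resp-⊆ S′⊆S)

Monotone⇒ordered : ∀ {B x y z S} → Unique B → Monotone B (x ∷ y ∷ z ∷ S) →
                   x ∷ y ∷ z ∷ [] ⊆ B ⊎ z ∷ y ∷ x ∷ [] ⊆ B
Monotone⇒ordered uB (inj₁ ((xy ∷ _) ∷ (yz ∷ _) ∷ _)) = inj₁ (Precedes-chain uB xy yz)
Monotone⇒ordered uB (inj₂ ((yx ∷ _) ∷ (zy ∷ _) ∷ _)) = inj₂ (Precedes-chain uB zy yx)

monotone-subsequence : ∀ {B n S} → HasChain (Precedes B) n S ⊎ HasChain (flip (Precedes B)) n S →
                       ∃ λ S′ → S′ ⊆ S × length S′ ≡ n × Monotone B S′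
monotone-subsequence (inj₁ (S′ , S′⊆S , len , chain)) = S′ , S′⊆S , len , inj₁ chain
monotone-subsequence (inj₂ (S′ , S′⊆S , len , chain)) = S′ , S′⊆S , len , inj₂ chain

esTower : ℕ → ℕ
esTower zero    = 3
esTower (suc n) = esBound (esTower n) (esTower n)

monotone-in-every-block : ∀ Bs S → Unique S → All (λ B → All (_∈ B) S) Bs →
                          esTower (length Bs) ≤ length S →
                          ∃ λ S′ → S′ ⊆ S × 3 ≤ length S′ × All (λ B → Monotone B S′) Bs
monotone-in-every-block [] S _ _ 3≤∣S∣ = S , ⊆-refl , 3≤∣S∣ , []
monotone-in-every-block (B ∷ Bs) S uS (S⊆B ∷ S⊆Bs) bound
  with monotone-subsequence (ErdősSzekeres.erdős-szekeres (Precedes B) Precedes-total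
                               (esTower (length Bs)) (esTower (length Bs)) S uS S⊆B bound)
... | S₁ , S₁⊆S , len , mono
  with monotone-in-every-block Bs S₁ (AllPairs-resp-⊆ S₁⊆S uS) (All.map (All-resp-⊆ S₁⊆S) S⊆Bs)
                               (≤-reflexive (sym len))
... | S₂ , S₂⊆S₁ , 3≤∣S₂∣ , monos = S₂ , ⊆-trans S₂⊆S₁ S₁⊆S , 3≤∣S₂∣ , Monotone-⊆ S₂⊆S₁ mono ∷ monos

orientations : ∀ {x y z} Bs → All (λ B → x ∷ y ∷ z ∷ [] ⊆ B ⊎ z ∷ y ∷ x ∷ [] ⊆ B) Bs →
               ∃ λ os → length os ≡ length Bs × map (rename3 x y z) (concat (map block os)) ⊆ concat Bs
orientations [] [] = [] , refl , []
orientations (B ∷ Bs) (ordered ∷ ordereds) with orientations Bs ordereds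
... | os , len , os⊆Bs with ordered
...   | inj₁ xyz⊆B = true  ∷ os , cong suc len , ++⁺ xyz⊆B os⊆Bs
...   | inj₂ zyx⊆B = false ∷ os , cong suc len , ++⁺ zyx⊆B os⊆Bs

map-rename3-acb : ∀ x y z u → map (rename3 x y z) (map (rename3 a c b) u) ≡ map (rename3 x z y) u
map-rename3-acb x y z u = trans (sym (map-∘ u)) (map-cong swap-y-z u)
  where
  swap-y-z : ∀ n → rename3 x y z (rename3 a c b n) ≡ rename3 x z y n
  swap-y-z 0             = refl
  swap-y-z 1             = refl
  swap-y-z (suc (suc n)) = refl

ordered-blocks-contain : ∀ t {x y z B} Bs → x ≢ y → x ≢ z → y ≢ z → x ∷ y ∷ z ∷ [] ⊆ B →
                         All (λ B → x ∷ y ∷ z ∷ [] ⊆ B ⊎ z ∷ y ∷ x ∷ [] ⊆ B) Bs → length Bs ≡ 2 * t →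
                         Contains (B ++ concat Bs) (abcACBt t)
ordered-blocks-contain t {x} {y} {z} {B} Bs x≢y x≢z y≢z xyz⊆B ordereds len
  with orientations Bs ordereds
... | os , len-os , os⊆Bs with orientations-contain t os (trans len-os len)
...   | inj₁ u⊆W  =
  Contains-rename3 t x≢y x≢z y≢z (⊆-trans (map⁺ (rename3 x y z) u⊆W) (++⁺ xyz⊆B os⊆Bs))
...   | inj₂ u′⊆W =
  Contains-rename3 t x≢z x≢y (y≢z ∘ sym)
    (subst (_⊆ B ++ concat Bs) (map-rename3-acb x y z (abcACBt t))
           (⊆-trans (map⁺ (rename3 x y z) u′⊆W) (++⁺ xyz⊆B os⊆Bs)))

formation-blocks-contain : ∀ t B Bs → Unique B → All Unique Bs → All (λ B′ → All (_∈ B′) B) Bs →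
                           length Bs ≡ 2 * t → esTower (2 * t) ≤ length B →
                           Contains (B ++ concat Bs) (abcACBt t)
formation-blocks-contain t B Bs uB uBs B⊆Bs len-Bs bound
  with monotone-in-every-block Bs B uB B⊆Bs (subst (λ n → esTower n ≤ length B) (sym len-Bs) bound)
... | [] , _ , () , _
... | _ ∷ [] , _ , s≤s () , _
... | _ ∷ _ ∷ [] , _ , s≤s (s≤s ()) , _
... | x ∷ y ∷ z ∷ S , xyzS⊆B , _ , monos with AllPairs-resp-⊆ xyzS⊆B uB
...   | (x≢y ∷ x≢z ∷ _) ∷ (y≢z ∷ _) ∷ _ =
  ordered-blocks-contain t Bs x≢y x≢z y≢z (⊆-trans (refl ∷ refl ∷ refl ∷ minimum S) xyzS⊆B)
    (All.zipWith (λ (uB′ , mono) → Monotone⇒ordered uB′ mono) (uBs , monos)) len-Bs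

formation-contains : ∀ t w → IsFormation (esTower (2 * t)) (2 * t + 1) w → Contains w (abcACBt t)
formation-contains t w (_ , _ , _ , [] , len , _ , _) = ⊥-elim (0≢1+n (trans len (+-comm (2 * t) 1)))
formation-contains t w (L , uL , lenL , B ∷ Bs , len , B↭L ∷ Bs↭L , refl) =
  formation-blocks-contain t B Bs (unique B↭L) (All.map unique Bs↭L) (All.map B⊆ Bs↭L)
    (suc-injective (trans len (+-comm (2 * t) 1))) (≤-reflexive (sym (trans (↭-length B↭L) lenL)))
  where
  unique : ∀ {B′} → B′ ↭ L → Unique B′
  unique B′↭L = Unique-resp-↭ˡ B′↭L uL
  B⊆ : ∀ {B′} → B′ ↭ L → All (_∈ B′) B
  B⊆ B′↭L = All.tabulate (∈-resp-↭ (↭-trans B↭L (↭-sym B′↭L)))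

-- Lower bound

alternating : Seq → Seq → ℕ → List Seq
alternating X Y zero    = []
alternating X Y (suc n) = X ∷ alternating Y X n

zigzag : Seq → Seq → ℕ → List Seq
zigzag X Y zero    = []
zigzag X Y (suc t) = X ∷ Y ∷ zigzag X Y t

alternating-double : ∀ X Y t → alternating X Y (2 * t) ≡ zigzag X Y t
alternating-double X Y zero    = refl
alternating-double X Y (suc t) =
  trans (cong (alternating X Y) (*-suc 2 t)) (cong (λ Bs → X ∷ Y ∷ Bs) (alternating-double X Y t))

alternating-⊆ : ∀ X Y {s n} → s ≤ n → concat (alternating X Y s) ⊆ concat (alternating X Y n)
alternating-⊆ X Y z≤n       = minimum _
alternating-⊆ X Y (s≤s s≤n) = ++⁺ ⊆-refl (alternating-⊆ Y X s≤n)

unmatched : Seq → Seq → Seq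
unmatched []      u       = u
unmatched (_ ∷ _) []      = []
unmatched (x ∷ B) (y ∷ u) with x ≟ y
... | yes _ = unmatched B u
... | no  _ = unmatched B (y ∷ u)

unmatched* : List Seq → Seq → Seq
unmatched* []       u = u
unmatched* (B ∷ Bs) u = unmatched* Bs (unmatched B u)

unmatched-∷ : ∀ B x u → unmatched B u ⊆ unmatched B (x ∷ u)
unmatched-∷ []      x u       = x ∷ʳ ⊆-refl
unmatched-∷ (y ∷ B) x []      = minimum _
unmatched-∷ (y ∷ B) x (z ∷ u) with y ≟ x | y ≟ z
... | yes _ | yes _ = unmatched-∷ B z u
... | yes _ | no  _ = ⊆-refl
... | no  _ | yes _ = ⊆-trans (unmatched-∷ B z u) (unmatched-∷ B x (z ∷ u))
... | no  _ | no  _ = unmatched-∷ B x (z ∷ u)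

unmatched-sound : ∀ B {u W} → u ⊆ B ++ W → unmatched B u ⊆ W
unmatched-sound []      u⊆W = u⊆W
unmatched-sound (y ∷ B) {[]} _ = minimum _
unmatched-sound (y ∷ B) {x ∷ u} (.y ∷ʳ xu⊆) with y ≟ x
... | yes _ = ⊆-trans (unmatched-∷ B x u) (unmatched-sound B xu⊆)
... | no  _ = unmatched-sound B xu⊆
unmatched-sound (y ∷ B) {x ∷ u} (x≡y ∷ u⊆) with y ≟ x
... | yes _   = unmatched-sound B u⊆
... | no  y≢x = ⊥-elim (y≢x (sym x≡y))

unmatched*-sound : ∀ Bs {u} → u ⊆ concat Bs → unmatched* Bs u ≡ []
unmatched*-sound []       [] = refl
unmatched*-sound (B ∷ Bs) u⊆ = unmatched*-sound Bs (unmatched-sound B u⊆)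

unmatched*-steady : ∀ π ρ S → (∀ X → unmatched ρ (unmatched π (S ++ a ∷ c ∷ b ∷ X)) ≡ S ++ X) →
                    ∀ m → unmatched* (zigzag π ρ m) (S ++ acb^ m) ≡ S
unmatched*-steady π ρ S steady zero    = ++-identityʳ S
unmatched*-steady π ρ S steady (suc m) rewrite steady (acb^ m) = unmatched*-steady π ρ S steady m

unmatched*-nonempty : ∀ π ρ s S →
                      (∀ X → unmatched ρ (unmatched π (s ∷ S ++ a ∷ c ∷ b ∷ X)) ≡ s ∷ S ++ X) →
                      ∀ m → unmatched* (zigzag π ρ m) (s ∷ S ++ acb^ m) ≢ []
unmatched*-nonempty π ρ s S steady m eq with trans (sym (unmatched*-steady π ρ (s ∷ S) steady m)) eq
... | ()

pattern 1st = here refl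
pattern 2nd = there (here refl)
pattern 3rd = there (there (here refl))

data Arrangement (x y z : A) : List A → Set where
  xyz : Arrangement x y z (x ∷ y ∷ z ∷ [])
  xzy : Arrangement x y z (x ∷ z ∷ y ∷ [])
  yxz : Arrangement x y z (y ∷ x ∷ z ∷ [])
  yzx : Arrangement x y z (y ∷ z ∷ x ∷ [])
  zxy : Arrangement x y z (z ∷ x ∷ y ∷ [])
  zyx : Arrangement x y z (z ∷ y ∷ x ∷ [])

-- The residue s ∷ S is what the first one to three pairs of blocks leave; after that each pair
-- consumes exactly three letters and leaves a residue of the same shape.
arrangement-avoids : ∀ {π} → Arrangement a b c π → ∀ t →
                     unmatched* (zigzag π (reverse π) t) (abcACBt t) ≢ []
arrangement-avoids xyz zero = λ ()
arrangement-avoids xyz (suc m) = unmatched*-nonempty _ _ c (b ∷ []) (λ X → refl) m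
arrangement-avoids xzy zero = λ ()
arrangement-avoids xzy (suc m) = unmatched*-nonempty _ _ c (b ∷ []) (λ X → refl) m
arrangement-avoids yxz zero = λ ()
arrangement-avoids yxz 1 = λ ()
arrangement-avoids yxz 2 = λ ()
arrangement-avoids yxz (suc (suc (suc m))) =
  unmatched*-nonempty _ _ a (c ∷ b ∷ a ∷ c ∷ b ∷ []) (λ X → refl) m
arrangement-avoids yzx zero = λ ()
arrangement-avoids yzx 1 = λ ()
arrangement-avoids yzx (suc (suc m)) = unmatched*-nonempty _ _ a (c ∷ b ∷ []) (λ X → refl) m
arrangement-avoids zxy zero = λ ()
arrangement-avoids zxy 1 = λ ()
arrangement-avoids zxy (suc (suc m)) = unmatched*-nonempty _ _ b (a ∷ c ∷ b ∷ []) (λ X → refl) m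
arrangement-avoids zyx zero = λ ()
arrangement-avoids zyx 1 = λ ()
arrangement-avoids zyx (suc (suc m)) = unmatched*-nonempty _ _ b (a ∷ c ∷ b ∷ []) (λ X → refl) m

Arrangement-map : ∀ {C : Set} {x y z : A} {x′ y′ z′ : C} {F} (f : A → C) →
                  f x ≡ x′ → f y ≡ y′ → f z ≡ z′ → Arrangement x y z F → Arrangement x′ y′ z′ (map f F)
Arrangement-map f refl refl refl xyz = xyz
Arrangement-map f refl refl refl xzy = xzy
Arrangement-map f refl refl refl yxz = yxz
Arrangement-map f refl refl refl yzx = yzx
Arrangement-map f refl refl refl zxy = zxy
Arrangement-map f refl refl refl zyx = zyx

arrangement-of-three : ∀ {x y z p q r : A} → Unique (p ∷ q ∷ r ∷ []) →
                       p ∈ x ∷ y ∷ z ∷ [] → q ∈ x ∷ y ∷ z ∷ [] → r ∈ x ∷ y ∷ z ∷ [] →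
                       Arrangement x y z (p ∷ q ∷ r ∷ [])
arrangement-of-three _ 1st 2nd 3rd = xyz
arrangement-of-three _ 1st 3rd 2nd = xzy
arrangement-of-three _ 2nd 1st 3rd = yxz
arrangement-of-three _ 2nd 3rd 1st = yzx
arrangement-of-three _ 3rd 1st 2nd = zxy
arrangement-of-three _ 3rd 2nd 1st = zyx
arrangement-of-three ((p≢q ∷ _) ∷ _) 1st 1st _ = ⊥-elim (p≢q refl)
arrangement-of-three ((p≢q ∷ _) ∷ _) 2nd 2nd _ = ⊥-elim (p≢q refl)
arrangement-of-three ((p≢q ∷ _) ∷ _) 3rd 3rd _ = ⊥-elim (p≢q refl)
arrangement-of-three ((_ ∷ p≢r ∷ _) ∷ _) 1st _ 1st = ⊥-elim (p≢r refl)
arrangement-of-three ((_ ∷ p≢r ∷ _) ∷ _) 2nd _ 2nd = ⊥-elim (p≢r refl)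
arrangement-of-three ((_ ∷ p≢r ∷ _) ∷ _) 3rd _ 3rd = ⊥-elim (p≢r refl)
arrangement-of-three (_ ∷ (q≢r ∷ _) ∷ _) _ 1st 1st = ⊥-elim (q≢r refl)
arrangement-of-three (_ ∷ (q≢r ∷ _) ∷ _) _ 2nd 2nd = ⊥-elim (q≢r refl)
arrangement-of-three (_ ∷ (q≢r ∷ _) ∷ _) _ 3rd 3rd = ⊥-elim (q≢r refl)
arrangement-of-three _ (there (there (there ()))) _ _
arrangement-of-three _ _ (there (there (there ()))) _
arrangement-of-three _ _ _ (there (there (there ())))

-- By pigeonhole a duplicate-free list that has exactly the letters x, y, z has length 3.
arrangement : ∀ {x y z : A} F → Unique (x ∷ y ∷ z ∷ []) → Unique F →
              All (_∈ x ∷ y ∷ z ∷ []) F → All (_∈ F) (x ∷ y ∷ z ∷ []) → Arrangement x y z F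
arrangement (p ∷ q ∷ r ∷ []) _ uF (p∈ ∷ q∈ ∷ r∈ ∷ []) _ = arrangement-of-three uF p∈ q∈ r∈
arrangement [] _ _ _ (() ∷ _)
arrangement (_ ∷ []) uT _ _ T⊆F with Unique⇒length≤ uT T⊆F
... | s≤s ()
arrangement (_ ∷ _ ∷ []) uT _ _ T⊆F with Unique⇒length≤ uT T⊆F
... | s≤s (s≤s ())
arrangement (_ ∷ _ ∷ _ ∷ _ ∷ _) _ uF F⊆T _ with Unique⇒length≤ uF F⊆T
... | s≤s (s≤s (s≤s ()))

filter-reverse : ∀ {P : Pred ℕ 0ℓ} (P? : Decidable P) xs → filter P? (reverse xs) ≡ reverse (filter P? xs)
filter-reverse P? [] = refl
filter-reverse P? (x ∷ xs)
  rewrite unfold-reverse x xs | filter-++ P? (reverse xs) [ x ] | filter-reverse P? xs with does (P? x)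
... | true  = sym (unfold-reverse x (filter P? xs))
... | false = ++-identityʳ _

module Restriction {P : Pred ℕ 0ℓ} (P? : Decidable P) (f : ℕ → ℕ) where

  restrict : Seq → Seq
  restrict X = map f (filter P? X)

  restrict-reverse : ∀ X → restrict (reverse X) ≡ reverse (restrict X)
  restrict-reverse X = trans (cong (map f) (filter-reverse P? X)) (reverse-map f (filter P? X))

  restrict-alternating : ∀ X Y s → restrict (concat (alternating X Y s)) ≡
                                   concat (alternating (restrict X) (restrict Y) s)
  restrict-alternating X Y zero    = refl
  restrict-alternating X Y (suc s) = begin
    map f (filter P? (X ++ concat (alternating Y X s)))
      ≡⟨ cong (map f) (filter-++ P? X _) ⟩
    map f (filter P? X ++ filter P? (concat (alternating Y X s)))
      ≡⟨ map-++ f (filter P? X) _ ⟩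
    restrict X ++ restrict (concat (alternating Y X s))
      ≡⟨ cong (restrict X ++_) (restrict-alternating Y X s) ⟩
    restrict X ++ concat (alternating (restrict Y) (restrict X) s) ∎
    where open ≡-Reasoning

∈-alternating⁻ : ∀ X Y s {x} → x ∈ concat (alternating X Y s) → x ∈ X ⊎ x ∈ Y
∈-alternating⁻ X Y zero ()
∈-alternating⁻ X Y (suc s) x∈ with ∈-++⁻ X x∈
... | inj₁ x∈X = inj₁ x∈X
... | inj₂ x∈rest = Sum.swap (∈-alternating⁻ Y X s x∈rest)

-- Only the three letters matched to  a, b, c  matter: restricting the formation to them and renaming by
-- the embedding leaves alternating copies of one arrangement of  a, b, c  that still contain the word.
contained-in-restriction : ∀ I s t → Unique I →
                           Contains (concat (alternating I (reverse I) s)) (abcACBt t) →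
                           ∃ λ π → Arrangement a b c π × abcACBt t ⊆ concat (alternating π (reverse π) s)
contained-in-restriction I s t uI (α ∷ β ∷ γ ∷ v , v⊆W , f , f-inj , fv≡u) = π , π-arrangement , u⊆
  where
  T : Seq
  T = α ∷ β ∷ γ ∷ []
  open Restriction (_∈? T) f

  fα : f α ≡ a
  fα = ∷-injectiveˡ fv≡u
  fβ : f β ≡ b
  fβ = ∷-injectiveˡ (∷-injectiveʳ fv≡u)
  fγ : f γ ≡ c
  fγ = ∷-injectiveˡ (∷-injectiveʳ (∷-injectiveʳ fv≡u))

  distinct : ∀ {x y m n} → f x ≡ m → f y ≡ n → m ≢ n → x ≢ y
  distinct fx fy m≢n refl = m≢n (trans (sym fx) fy)

  uT : Unique T
  uT = (distinct fα fβ (λ ()) ∷ distinct fα fγ (λ ()) ∷ []) ∷ (distinct fβ fγ (λ ()) ∷ []) ∷ [] ∷ []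

  in-T : ∀ {x} → x ∈ α ∷ β ∷ γ ∷ v → x ∈ T
  in-T {x} x∈ with f x in fx | All.lookup (abcACBt-letters t) (subst (f x ∈_) fv≡u (∈-map⁺ f x∈))
  ... | 0 | _ = here (f-inj x∈ 1st (trans fx (sym fα)))
  ... | 1 | _ = there (here (f-inj x∈ 2nd (trans fx (sym fβ))))
  ... | 2 | _ = there (there (here (f-inj x∈ 3rd (trans fx (sym fγ)))))
  ... | suc (suc (suc _)) | s≤s (s≤s (s≤s ()))

  W : Seq
  W = concat (alternating I (reverse I) s)

  in-I : ∀ {x} → x ∈ W → x ∈ I
  in-I x∈ with ∈-alternating⁻ I (reverse I) s x∈
  ... | inj₁ x∈I  = x∈I
  ... | inj₂ x∈I′ = ∈-resp-↭ (↭-reverse I) x∈I′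

  F : Seq
  F = filter (_∈? T) I

  T⊆F : All (_∈ F) T
  T⊆F = All.map (λ x∈ → ∈-filter⁺ (_∈? T) (in-I (lookup v⊆W x∈)) (in-T x∈))
                (1st ∷ 2nd ∷ 3rd ∷ [])

  π : Seq
  π = restrict I

  π-arrangement : Arrangement a b c π
  π-arrangement = Arrangement-map f fα fβ fγ
    (arrangement F uT (Unique.filter⁺ (_∈? T) uI) (all-filter (_∈? T) I) T⊆F)

  v⊆filter : α ∷ β ∷ γ ∷ v ⊆ filter (_∈? T) W
  v⊆filter = subst (_⊆ filter (_∈? T) W) (filter-all (_∈? T) (All.tabulate in-T))
                   (filter⁺ (_∈? T) (_∈? T) (λ { refl x∈ → x∈ }) v⊆W)

  restrict-W : restrict W ≡ concat (alternating π (reverse π) s)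
  restrict-W = trans (restrict-alternating I (reverse I) s)
                     (cong (λ ρ → concat (alternating π ρ s)) (restrict-reverse I))

  u⊆ : abcACBt t ⊆ concat (alternating π (reverse π) s)
  u⊆ = subst₂ _⊆_ fv≡u restrict-W (map⁺ f v⊆filter)

alternating-avoids : ∀ I t s → Unique I → s ≤ 2 * t →
                     ¬ Contains (concat (alternating I (reverse I) s)) (abcACBt t)
alternating-avoids I t s uI s≤2t contains with contained-in-restriction I s t uI contains
... | π , π-arrangement , u⊆ = arrangement-avoids π-arrangement t
  (unmatched*-sound (zigzag π (reverse π) t)
    (subst (λ Bs → abcACBt t ⊆ concat Bs) (alternating-double π (reverse π) t)
      (⊆-trans u⊆ (alternating-⊆ π (reverse π) s≤2t))))

alternating-formation : ∀ r s → IsFormation r s (concat (alternating (upTo r) (reverse (upTo r)) s))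
alternating-formation r s =
  upTo r , Unique.upTo⁺ r , length-upTo r , alternating (upTo r) (reverse (upTo r)) s ,
  length-alternating (upTo r) (reverse (upTo r)) s ,
  all-↭ (upTo r) (reverse (upTo r)) s ↭-refl (↭-reverse (upTo r)) , refl
  where
  length-alternating : ∀ X Y s → length (alternating X Y s) ≡ s
  length-alternating X Y zero    = refl
  length-alternating X Y (suc s) = cong suc (length-alternating Y X s)
  all-↭ : ∀ X Y s → X ↭ upTo r → Y ↭ upTo r → All (_↭ upTo r) (alternating X Y s)
  all-↭ X Y zero    _   _   = []
  all-↭ X Y (suc s) X↭I Y↭I = X↭I ∷ all-↭ Y X s Y↭I X↭I

no-smaller-width : ∀ t s → s < 2 * t + 1 → ¬ FwProp (abcACBt t) s
no-smaller-width t s s<2t+1 (r , every-formation-contains) =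
  alternating-avoids (upTo r) t s (Unique.upTo⁺ r) (m<1+n⇒m≤n (subst (s <_) (+-comm (2 * t) 1) s<2t+1))
    (every-formation-contains _ (alternating-formation r s))

lemma4p7 : (t : ℕ) → FwIs (abcACBt t) (2 * t + 1)
lemma4p7 t = (esTower (2 * t) , formation-contains t) , no-smaller-width t
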